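{- Let $G$ be a connected graph with vertex set $\{v_1,\dots,v_n\}$ and let $\mathcal H=\{H_1,\dots,H_n\}$ be a family of pairwise vertex-disjoint graphs (each with at least one vertex). Then the generalized corona $G\odot\mathcal H$ is Class~$1$, i.e. $\gamma_{\rm tcg}(G\odot\mathcal H)=\gamma_{\rm cg}(G\odot\mathcal H)+1$.
   Context: All graphs are finite and simple. The generalized corona $G\odot\mathcal H$ is obtained from the disjoint union of $G,H_1,\dots,H_n$ by joining, for each $i\in[n]$, every vertex of $H_i$ to $v_i$. The connected domination game on a connected graph $X$ is played by Dominator and Staller, who alternately select previously unselected vertices, Dominator moving first; each selected vertex must dominate (have in its closed neighborhood) at least one vertex not dominated by previously selected vertices, and at every stage the selected vertices must induce a connected subgraph. The game ends when no legal move exists; Dominator minimizes and Staller maximizes the number of selected vertices; the optimal value is $\gamma_{\rm cg}(X)$. The total connected domination game is the same except each selected vertex must totally dominate (have in its open neighborhood) at least one vertex not yet totally dominated by previously selected vertices; its optimal value is $\gamma_{\rm tcg}(X)$. A connected graph $X$ is Class~$i$ ($i\in\{0,1,2\}$) if $\gamma_{\rm tcg}(X)=\gamma_{\rm cg}(X)+i$. -}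

module Defs where

open import Data.Nat using (ℕ; suc; _≤_)
open import Data.Fin using (Fin; _≟_)
open import Data.Bool using (Bool; true; false)
open import Data.Unit using (⊤)
open import Data.Product using (Σ; ∃; _×_; _,_)
open import Data.Sum using (_⊎_; inj₁; inj₂)
open import Data.List using (List; []; _∷_; length)
open import Data.List.Membership.Propositional using (_∈_; _∉_)
open import Relation.Nullary using (¬_; yes; no; does)
open import Relation.Binary.PropositionalEquality using (_≡_; refl; sym)

record Graph (V : Set) : Set where
  field
    adj    : V → V → Bool
    adj-sym    : ∀ u v → adj u v ≡ adj v u
    adj-irrefl : ∀ v → adj v v ≡ false
open Graph public

Adj : ∀ {V} → Graph V → V → V → Set
Adj G u v = adj G u v ≡ true

-- Walks all of whose vertices satisfy P (P = ⊤ : ordinary walks).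
data Walk {V : Set} (G : Graph V) (P : V → Set) : V → V → Set where
  here : ∀ {v} → P v → Walk G P v v
  step : ∀ {u w v} → P u → Adj G u w → Walk G P w v → Walk G P u v

Connected : ∀ {V} → Graph V → Set
Connected {V} G = V × (∀ u v → Walk G (λ _ → ⊤) u v)

InducedConnected : ∀ {V} → Graph V → List V → Set
InducedConnected G S = ∀ u v → u ∈ S → v ∈ S → Walk G (_∈ S) u v

-- Generalized corona G ⊙ H with H i having suc (k i) ≥ 1 vertices.

CoronaV : (n : ℕ) → (Fin n → ℕ) → Set
CoronaV n k = Fin n ⊎ Σ (Fin n) (λ i → Fin (suc (k i)))

module _ {n : ℕ} (G : Graph (Fin n)) (k : Fin n → ℕ)
         (H : (i : Fin n) → Graph (Fin (suc (k i)))) where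

  coronaAdj : CoronaV n k → CoronaV n k → Bool
  coronaAdj (inj₁ i) (inj₁ j) = adj G i j
  coronaAdj (inj₁ i) (inj₂ (j , _)) = does (i ≟ j)
  coronaAdj (inj₂ (i , _)) (inj₁ j) = does (i ≟ j)
  coronaAdj (inj₂ (i , a)) (inj₂ (j , b)) with i ≟ j
  ... | yes refl = adj (H i) a b
  ... | no _ = false

  private
    eqsym : (i j : Fin n) → does (i ≟ j) ≡ does (j ≟ i)
    eqsym i j with i ≟ j | j ≟ i
    ... | yes _ | yes _ = refl
    ... | no _ | no _ = refl
    ... | yes p | no q = Data.Empty.⊥-elim (q (sym p))
      where import Data.Empty
    ... | no p | yes q = Data.Empty.⊥-elim (p (sym q))
      where import Data.Empty

    csym : ∀ u v → coronaAdj u v ≡ coronaAdj v u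
    csym (inj₁ i) (inj₁ j) = adj-sym G i j
    csym (inj₁ i) (inj₂ (j , _)) = eqsym i j
    csym (inj₂ (i , _)) (inj₁ j) = eqsym i j
    csym (inj₂ (i , a)) (inj₂ (j , b)) with i ≟ j | j ≟ i
    ... | yes refl | yes refl = adj-sym (H i) a b
    ... | no _ | no _ = refl
    ... | yes p | no q = Data.Empty.⊥-elim (q (sym p))
      where import Data.Empty
    ... | no p | yes q = Data.Empty.⊥-elim (p (sym q))
      where import Data.Empty

    cirr : ∀ v → coronaAdj v v ≡ false
    cirr (inj₁ i) = adj-irrefl G i
    cirr (inj₂ (i , a)) with i ≟ i
    ... | yes refl = adj-irrefl (H i) a
    ... | no _ = refl

  corona : Graph (CoronaV n k)
  corona = record { adj = coronaAdj ; adj-sym = csym ; adj-irrefl = cirr }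

-- Games.  A position is the list of selected vertices.

data Player : Set where
  dominator staller : Player

module Game {V : Set} (Legal : List V → V → Set) where

  NoMove : List V → Set
  NoMove S = ∀ v → ¬ Legal S v

  data DomAtMost (m : ℕ) : List V → Player → Set where
    end   : ∀ {S p} → NoMove S → length S ≤ m → DomAtMost m S p
    dmove : ∀ {S} v → Legal S v → DomAtMost m (v ∷ S) staller
          → DomAtMost m S dominator
    smove : ∀ {S} → ∃ (Legal S)
          → (∀ v → Legal S v → DomAtMost m (v ∷ S) dominator)
          → DomAtMost m S staller

  data StalAtLeast (m : ℕ) : List V → Player → Set where
    end   : ∀ {S p} → NoMove S → m ≤ length S → StalAtLeast m S p
    smove : ∀ {S} v → Legal S v → StalAtLeast m (v ∷ S) dominator
          → StalAtLeast m S staller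
    dmove : ∀ {S} → ∃ (Legal S)
          → (∀ v → Legal S v → StalAtLeast m (v ∷ S) staller)
          → StalAtLeast m S dominator

  GameValue : ℕ → Set
  GameValue m = DomAtMost m [] dominator × StalAtLeast m [] dominator

module _ {V : Set} (X : Graph V) where

  ClosedNbr : V → V → Set
  ClosedNbr v u = u ≡ v ⊎ Adj X v u

  Dominated : List V → V → Set
  Dominated S u = ∃ λ w → w ∈ S × ClosedNbr w u

  TotallyDominated : List V → V → Set
  TotallyDominated S u = ∃ λ w → w ∈ S × Adj X w u

  LegalCG : List V → V → Set
  LegalCG S v = v ∉ S × (∃ λ u → ClosedNbr v u × ¬ Dominated S u)
                × InducedConnected X (v ∷ S)

  LegalTCG : List V → V → Set
  LegalTCG S v = v ∉ S × (∃ λ u → Adj X v u × ¬ TotallyDominated S u)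
                 × InducedConnected X (v ∷ S)

  IsγCG : ℕ → Set
  IsγCG = Game.GameValue LegalCG

  IsγTCG : ℕ → Set
  IsγTCG = Game.GameValue LegalTCG

-- Write v_i for the hub and V(H_i) for the leaves of part i.  Since the selected vertices stay
-- connected, once some hub is selected a leaf of part i can be played only if v_i is already
-- selected, and then everything the leaf (totally) dominates is already (totally) dominated
-- through v_i (in the total game a selected hub is totally dominated by its selected neighbour).
-- So after Dominator opens with a hub only hubs are playable, except that Staller's first reply
-- in the total game may be a leaf: γ_cg ≤ n and γ_tcg ≤ n + 1.  Conversely a leaf of part i is
-- (totally) dominated only from inside part i, so a finished game has selected a vertex in each
-- of the n parts; in the total game a leaf h is selected too (Staller answers a hub opening with
-- a leaf), and the vertex totally dominating h is a second selected vertex in the part of h: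
-- γ_cg ≥ n and γ_tcg ≥ n + 1.
module Submission where

open import Defs
open import Data.Nat using (ℕ; zero; suc; _≤_; _+_)
open import Data.Nat.Properties using (≤-trans; ≤-reflexive; +-suc; m≤m+n; 1+n≰n)
open import Data.Fin using (Fin; _≟_) renaming (zero to fzero; suc to fsuc)
open import Data.Fin.Properties using (injective⇒≤)
open import Data.Product using (Σ; ∃; ∃₂; _×_; _,_; proj₁; proj₂)
import Data.Product.Properties as Product
open import Data.Sum using (_⊎_; inj₁; inj₂)
import Data.Sum.Properties as Sum
open import Data.Bool using (true)
import Data.Bool.Properties as Bool
open import Data.Unit using (⊤; tt)
open import Data.Empty using (⊥-elim)
open import Data.List using (List; []; _∷_; length; lookup; map; _++_; concatMap; allFin)
open import Data.List.Properties using (length-map; length-tabulate)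
open import Data.List.Membership.Propositional using (_∈_; _∉_; find; lose)
open import Data.List.Membership.Propositional.Properties
  using (∈-lookup; ∈-map⁺; ∈-++⁺ˡ; ∈-++⁺ʳ; ∈-concatMap⁺; ∈-allFin)
open import Data.List.Membership.Setoid.Properties using (index-injective)
open import Data.List.Relation.Binary.Subset.Propositional using (_⊆_)
open import Data.List.Relation.Unary.Any using (here; there; any?)
import Data.List.Relation.Unary.All as All
open import Data.List.Relation.Unary.All.Properties using (¬All⇒Any¬; ¬Any⇒All¬)
open import Data.List.Relation.Unary.AllPairs using ([]; _∷_)
open import Data.List.Relation.Unary.Unique.Propositional using (Unique)
open import Function using (_∘_)
open import Function.Definitions using (Injective)
open import Relation.Nullary using (¬_; Dec; yes; no; does)
open import Relation.Nullary.Decidable using (dec-true; map′)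
open import Relation.Unary using (Decidable)
open import Relation.Binary.Definitions using (DecidableEquality)
open import Relation.Binary.PropositionalEquality
  using (_≡_; _≢_; refl; sym; trans; cong; subst; setoid)

dec-true⁻ : ∀ {A : Set} (a? : Dec A) → does a? ≡ true → A
dec-true⁻ (yes a) _ = a

module _ {A : Set} where

  Unique⇒lookup-injective : ∀ {xs : List A} → Unique xs → Injective _≡_ _≡_ (lookup xs)
  Unique⇒lookup-injective (_ ∷ _) {fzero} {fzero} _ = refl
  Unique⇒lookup-injective (x∉xs ∷ _) {fzero} {fsuc j} eq = ⊥-elim (All.lookup x∉xs (∈-lookup j) eq)
  Unique⇒lookup-injective (x∉xs ∷ _) {fsuc i} {fzero} eq =
    ⊥-elim (All.lookup x∉xs (∈-lookup i) (sym eq))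
  Unique⇒lookup-injective (_ ∷ u) {fsuc i} {fsuc j} eq = cong fsuc (Unique⇒lookup-injective u eq)

  injection⇒≤-length : ∀ {m} {xs : List A} (f : Fin m → A) →
                       Injective _≡_ _≡_ f → (∀ i → f i ∈ xs) → m ≤ length xs
  injection⇒≤-length f f-inj f∈xs =
    injective⇒≤ (λ eq → f-inj (index-injective (setoid A) (f∈xs _) (f∈xs _) eq))

  injection⇒suc≤-length : ∀ {m} {xs : List A} {x} (f : Fin m → A) →
                          Injective _≡_ _≡_ f → (∀ i → f i ∈ xs) →
                          x ∈ xs → (∀ i → f i ≢ x) → suc m ≤ length xs
  injection⇒suc≤-length {xs = xs} {x} f f-inj f∈xs x∈xs f≢x = injection⇒≤-length g g-inj g∈xs
    where
    g : Fin (suc _) → A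
    g fzero = x
    g (fsuc i) = f i

    g-inj : Injective _≡_ _≡_ g
    g-inj {fzero} {fzero} _ = refl
    g-inj {fzero} {fsuc j} eq = ⊥-elim (f≢x j (sym eq))
    g-inj {fsuc i} {fzero} eq = ⊥-elim (f≢x i eq)
    g-inj {fsuc i} {fsuc j} eq = cong fsuc (f-inj eq)

    g∈xs : ∀ i → g i ∈ xs
    g∈xs fzero = x∈xs
    g∈xs (fsuc i) = f∈xs i

  Unique⇒length≤ : ∀ {xs ys : List A} → Unique xs → xs ⊆ ys → length xs ≤ length ys
  Unique⇒length≤ {xs} u xs⊆ys =
    injection⇒≤-length (lookup xs) (Unique⇒lookup-injective u) (xs⊆ys ∘ ∈-lookup)

module GraphProperties {V : Set} (X : Graph V) where

  Adj-sym : ∀ {u v} → Adj X u v → Adj X v u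
  Adj-sym {u} {v} a = trans (adj-sym X v u) a

  Adj-irrefl : ∀ {v} → ¬ Adj X v v
  Adj-irrefl {v} a with () ← trans (sym a) (adj-irrefl X v)

  Walk-head : ∀ {P u v} → Walk X P u v → P u
  Walk-head (here p) = p
  Walk-head (step p _ _) = p

  Walk-map : ∀ {P Q : V → Set} → (∀ {z} → P z → Q z) → ∀ {u v} → Walk X P u v → Walk X Q u v
  Walk-map f (here p) = here (f p)
  Walk-map f (step p a w) = step (f p) a (Walk-map f w)

  Walk-snoc : ∀ {P u v w} → Walk X P u v → Adj X v w → P w → Walk X P u w
  Walk-snoc (here p) a pw = step p a (here pw)
  Walk-snoc (step p a w) b pw = step p a (Walk-snoc w b pw)

  Walk-++ : ∀ {P u v w} → Walk X P u v → Walk X P v w → Walk X P u w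
  Walk-++ (here _) r = r
  Walk-++ (step p a w) r = step p a (Walk-++ w r)

  Walk-leaves : ∀ {P} (D : V → Set) → Decidable D → ∀ {x u} → Walk X P x u → D x → ¬ D u →
                ∃₂ λ y w → D y × Adj X y w × ¬ D w
  Walk-leaves D D? (here _) dx ¬du = ⊥-elim (¬du dx)
  Walk-leaves D D? {x} (step {w = w} _ a rest) dx ¬du with D? w
  ... | yes dw = Walk-leaves D D? rest dw ¬du
  ... | no ¬dw = x , w , dx , a , ¬dw

  InducedConnected-[] : InducedConnected X []
  InducedConnected-[] _ _ ()

  InducedConnected-[_] : ∀ x → InducedConnected X (x ∷ [])
  InducedConnected-[ x ] _ _ (here refl) (here refl) = here (here refl)

  InducedConnected-∷ : ∀ {S x y} → InducedConnected X S → y ∈ S → Adj X x y →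
                       InducedConnected X (x ∷ S)
  InducedConnected-∷ c y∈S a _ _ (here refl) (here refl) = here (here refl)
  InducedConnected-∷ {y = y} c y∈S a _ v (here refl) (there v∈S) =
    step (here refl) a (Walk-map there (c y v y∈S v∈S))
  InducedConnected-∷ {y = y} c y∈S a u _ (there u∈S) (here refl) =
    Walk-snoc (Walk-map there (c u y u∈S y∈S)) (Adj-sym a) (here refl)
  InducedConnected-∷ c y∈S a u v (there u∈S) (there v∈S) = Walk-map there (c u v u∈S v∈S)

  InducedConnected⇒adjacent : ∀ {S v s} → v ∉ S → s ∈ S → InducedConnected X (v ∷ S) →
                              ∃ λ w → w ∈ S × Adj X v w
  InducedConnected⇒adjacent v∉S s∈S c with c _ _ (here refl) (there s∈S)
  ... | here _ = ⊥-elim (v∉S s∈S)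
  ... | step _ a rest with Walk-head rest
  ...   | here refl = ⊥-elim (Adj-irrefl a)
  ...   | there w∈S = _ , w∈S , a

  -- Every position reached in either game is of this form.
  Position : List V → Set
  Position S = Unique S × InducedConnected X S

  Position-[] : Position []
  Position-[] = [] , InducedConnected-[]

  -- Both LegalCG X S v and LegalTCG X S v have the shape of the second argument.
  Position-move : ∀ {A : Set} {S v} → Position S → v ∉ S × A × InducedConnected X (v ∷ S) →
                  Position (v ∷ S)
  Position-move (u , _) (v∉S , _ , c) = ¬Any⇒All¬ _ v∉S ∷ u , c

module Play {V : Set} (Legal : List V → V → Set) (Inv : List V → Set)
            (Inv-step : ∀ {S v} → Inv S → Legal S v → Inv (v ∷ S))
            (stuck⊎move : ∀ {S} → Inv S → Game.NoMove Legal S ⊎ ∃ (Legal S))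
            (B : ℕ) (Inv-length≤ : ∀ {S} → Inv S → length S ≤ B) where
  open Game Legal

  private
    no-move-beyond : ∀ {S v} → Inv S → Legal S v → ¬ B ≤ length S
    no-move-beyond inv l B≤ = 1+n≰n (≤-trans (Inv-length≤ (Inv-step inv l)) B≤)

    refuel : ∀ f (S : List V) → B ≤ suc f + length S → B ≤ f + suc (length S)
    refuel f S = subst (B ≤_) (sym (+-suc f (length S)))

  -- The fuel f of go satisfies B ≤ f + length S, so it runs out only when no move is left.
  DomAtMost-bound : ∀ {S} p → Inv S → DomAtMost B S p
  DomAtMost-bound {S} p inv = go B p inv (m≤m+n B (length S))
    where
    go : ∀ f {S} p → Inv S → B ≤ f + length S → DomAtMost B S p
    go f p inv B≤ with stuck⊎move inv
    ... | inj₁ stuck = end stuck (Inv-length≤ inv)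
    go zero p inv B≤ | inj₂ (_ , l) = ⊥-elim (no-move-beyond inv l B≤)
    go (suc f) {S} dominator inv B≤ | inj₂ (v , l) =
      dmove v l (go f {v ∷ S} staller (Inv-step inv l) (refuel f S B≤))
    go (suc f) {S} staller inv B≤ | inj₂ move =
      smove move (λ v l → go f {v ∷ S} dominator (Inv-step inv l) (refuel f S B≤))

  StalAtLeast-terminal : ∀ m → (∀ {S} → Inv S → NoMove S → m ≤ length S) →
                         ∀ {S} p → Inv S → StalAtLeast m S p
  StalAtLeast-terminal m terminal {S} p inv = go B p inv (m≤m+n B (length S))
    where
    go : ∀ f {S} p → Inv S → B ≤ f + length S → StalAtLeast m S p
    go f p inv B≤ with stuck⊎move inv
    ... | inj₁ stuck = end stuck (terminal inv stuck)
    go zero p inv B≤ | inj₂ (_ , l) = ⊥-elim (no-move-beyond inv l B≤)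
    go (suc f) {S} staller inv B≤ | inj₂ (v , l) =
      smove v l (go f {v ∷ S} dominator (Inv-step inv l) (refuel f S B≤))
    go (suc f) {S} dominator inv B≤ | inj₂ move =
      dmove move (λ v l → go f {v ∷ S} staller (Inv-step inv l) (refuel f S B≤))

module FiniteConnected {V : Set} (X : Graph V) (_≟ᵥ_ : DecidableEquality V)
                       (vertices : List V) (∈-vertices : ∀ v → v ∈ vertices)
                       (walk : ∀ u v → Walk X (λ _ → ⊤) u v) where
  open GraphProperties X

  Adj? : ∀ w u → Dec (Adj X w u)
  Adj? w u = adj X w u Bool.≟ true

  ClosedNbr? : ∀ w u → Dec (ClosedNbr X w u)
  ClosedNbr? w u with u ≟ᵥ w | Adj? w u
  ... | yes u≡w | _ = yes (inj₁ u≡w)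
  ... | no _ | yes a = yes (inj₂ a)
  ... | no u≢w | no ¬a = no λ { (inj₁ u≡w) → u≢w u≡w ; (inj₂ a) → ¬a a }

  Dominated? : ∀ S → Decidable (Dominated X S)
  Dominated? S u = map′ find (λ (w , w∈S , c) → lose w∈S c) (any? (λ w → ClosedNbr? w u) S)

  TotallyDominated? : ∀ S → Decidable (TotallyDominated X S)
  TotallyDominated? S u = map′ find (λ (w , w∈S , a) → lose w∈S a) (any? (λ w → Adj? w u) S)

  Position-length≤ : ∀ {S} → Position S → length S ≤ length vertices
  Position-length≤ (u , _) = Unique⇒length≤ u (λ {v} _ → ∈-vertices v)

  private
    legal⇒undominated : ∀ {A B : Set} {R D : V → Set} →
                        A × (∃ λ u → R u × ¬ D u) × B → ∃ λ u → ¬ D u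
    legal⇒undominated (_ , (u , _ , ¬du) , _) = u , ¬du

    module Stuck (Legal : List V → V → Set) (D : List V → V → Set) {S : List V}
                 (D? : Decidable (D S)) (witness : ∀ {v} → Legal S v → ∃ λ u → ¬ D S u)
                 (move : ∀ {u} → ¬ D S u → ∃ (Legal S)) where

      stuck⊎move : Game.NoMove Legal S ⊎ ∃ (Legal S)
      stuck⊎move with All.all? D? vertices
      ... | yes all = inj₁ λ v l → proj₂ (witness l) (All.lookup all (∈-vertices _))
      ... | no ¬all = let (u , _ , ¬du) = find (¬All⇒Any¬ D? vertices ¬all) in inj₂ (move ¬du)

      stuck⇒all : Game.NoMove Legal S → ∀ u → D S u
      stuck⇒all stuck u with D? u
      ... | yes du = du
      ... | no ¬du = let (v , l) = move ¬du in ⊥-elim (stuck v l)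

  LegalCG-at-boundary : ∀ {S x w} → InducedConnected X S → Dominated X S x → Adj X x w →
                        ¬ Dominated X S w → LegalCG X S x
  LegalCG-at-boundary {x = x} c (y , y∈S , inj₁ refl) a ¬dw = ⊥-elim (¬dw (x , y∈S , inj₂ a))
  LegalCG-at-boundary {x = x} c (y , y∈S , inj₂ ay) a ¬dw =
    (λ x∈S → ¬dw (x , x∈S , inj₂ a)) , (_ , inj₂ a , ¬dw) , InducedConnected-∷ c y∈S (Adj-sym ay)

  LegalCG-exists : ∀ {S u} → InducedConnected X S → ¬ Dominated X S u → ∃ (LegalCG X S)
  LegalCG-exists {[]} {u} _ ¬du = u , (λ ()) , (u , inj₁ refl , ¬du) , InducedConnected-[ u ]
  LegalCG-exists {s ∷ S} {u} c ¬du =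
    let (x , w , dx , a , ¬dw) = Walk-leaves (Dominated X (s ∷ S)) (Dominated? (s ∷ S))
                                             (walk s u) (s , here refl , inj₁ refl) ¬du
    in x , LegalCG-at-boundary c dx a ¬dw

  LegalTCG-at-boundary : ∀ {S x w} → InducedConnected X S → TotallyDominated X S x → Adj X x w →
                         ¬ TotallyDominated X S w → LegalTCG X S x
  LegalTCG-at-boundary c (y , y∈S , ay) a ¬dw =
    (λ x∈S → ¬dw (_ , x∈S , a)) , (_ , a , ¬dw) , InducedConnected-∷ c y∈S (Adj-sym ay)

  LegalTCG-exists : (∀ u → ∃ λ w → Adj X w u) →
                    ∀ {S u} → InducedConnected X S → ¬ TotallyDominated X S u → ∃ (LegalTCG X S)
  LegalTCG-exists nbr {[]} {u} _ ¬du =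
    let (w , a) = nbr u in w , (λ ()) , (u , a , ¬du) , InducedConnected-[ w ]
  LegalTCG-exists nbr {s ∷ S} {u} c ¬du with TotallyDominated? (s ∷ S) s
  ... | yes ds =
    let (x , w , dx , a , ¬dw) = Walk-leaves (TotallyDominated X (s ∷ S))
                                             (TotallyDominated? (s ∷ S)) (walk s u) ds ¬du
    in x , LegalTCG-at-boundary c dx a ¬dw
  ... | no ¬ds =
    let (w , a) = nbr s in
    w , (λ w∈S → ¬ds (w , w∈S , a)) , (s , a , ¬ds) , InducedConnected-∷ c (here refl) a

  stuck⊎LegalCG : ∀ {S} → Position S → Game.NoMove (LegalCG X) S ⊎ ∃ (LegalCG X S)
  stuck⊎LegalCG {S} (_ , c) = stuck⊎move
    where open Stuck (LegalCG X) (Dominated X) (Dominated? S) legal⇒undominated (LegalCG-exists c)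

  stuck⇒dominating : ∀ {S} → Position S → Game.NoMove (LegalCG X) S → ∀ u → Dominated X S u
  stuck⇒dominating {S} (_ , c) = stuck⇒all
    where open Stuck (LegalCG X) (Dominated X) (Dominated? S) legal⇒undominated (LegalCG-exists c)

  module _ (nbr : ∀ u → ∃ λ w → Adj X w u) where

    stuck⊎LegalTCG : ∀ {S} → Position S → Game.NoMove (LegalTCG X) S ⊎ ∃ (LegalTCG X S)
    stuck⊎LegalTCG {S} (_ , c) = stuck⊎move
      where open Stuck (LegalTCG X) (TotallyDominated X) (TotallyDominated? S)
                       legal⇒undominated (LegalTCG-exists nbr c)

    stuck⇒totallyDominating : ∀ {S} → Position S → Game.NoMove (LegalTCG X) S →
                              ∀ u → TotallyDominated X S u
    stuck⇒totallyDominating {S} (_ , c) = stuck⇒all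
      where open Stuck (LegalTCG X) (TotallyDominated X) (TotallyDominated? S)
                       legal⇒undominated (LegalTCG-exists nbr c)

module CoronaProperties {n : ℕ} (G : Graph (Fin n)) (k : Fin n → ℕ)
                        (H : (i : Fin n) → Graph (Fin (suc (k i)))) where

  X : Graph (CoronaV n k)
  X = corona G k H

  open GraphProperties X

  part : CoronaV n k → Fin n
  part (inj₁ i) = i
  part (inj₂ (i , _)) = i

  _≟ᵥ_ : DecidableEquality (CoronaV n k)
  _≟ᵥ_ = Sum.≡-dec _≟_ (Product.≡-dec _≟_ _≟_)

  hub-adj-leaf : ∀ i a → Adj X (inj₁ i) (inj₂ (i , a))
  hub-adj-leaf i a = dec-true (i ≟ i) refl

  leaf-adj-hub : ∀ i a → Adj X (inj₂ (i , a)) (inj₁ i)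
  leaf-adj-hub i a = dec-true (i ≟ i) refl

  leaf-adj⇒same-part : ∀ {j a u} → Adj X (inj₂ (j , a)) u → part u ≡ j
  leaf-adj⇒same-part {j} {u = inj₁ i} e = sym (dec-true⁻ (j ≟ i) e)
  leaf-adj⇒same-part {j} {u = inj₂ (i , b)} e with j ≟ i
  ... | yes refl = refl
  leaf-adj⇒same-part {j} {u = inj₂ (i , b)} () | no _

  dominates-leaf⇒same-part : ∀ {j a w} → ClosedNbr X w (inj₂ (j , a)) → part w ≡ j
  dominates-leaf⇒same-part (inj₁ refl) = refl
  dominates-leaf⇒same-part {j} {a} {w} (inj₂ e) = leaf-adj⇒same-part {j} {a} {w} (Adj-sym {w} e)

  leaf-ClosedNbr⇒hub-ClosedNbr : ∀ {j a u} → ClosedNbr X (inj₂ (j , a)) u → ClosedNbr X (inj₁ j) u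
  leaf-ClosedNbr⇒hub-ClosedNbr {j} {a} (inj₁ refl) = inj₂ (hub-adj-leaf j a)
  leaf-ClosedNbr⇒hub-ClosedNbr {j} {a} {inj₁ i} (inj₂ e)
    with refl ← leaf-adj⇒same-part {j} {a} {inj₁ i} e = inj₁ refl
  leaf-ClosedNbr⇒hub-ClosedNbr {j} {a} {inj₂ (i , b)} (inj₂ e)
    with refl ← leaf-adj⇒same-part {j} {a} {inj₂ (i , b)} e =
    inj₂ (hub-adj-leaf i b)

  Walk-leaf→hub : ∀ {P j a i} → Walk X P (inj₂ (j , a)) (inj₁ i) → P (inj₁ j)
  Walk-leaf→hub {j = j} {a} (step {w = w@(inj₁ _)} _ e rest)
    with refl ← leaf-adj⇒same-part {j} {a} {w} e = Walk-head rest
  Walk-leaf→hub {j = j} {a} (step {w = w@(inj₂ _)} _ e rest)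
    with refl ← leaf-adj⇒same-part {j} {a} {w} e = Walk-leaf→hub rest

  has-neighbour : ∀ u → ∃ λ w → Adj X w u
  has-neighbour (inj₁ i) = inj₂ (i , fzero) , leaf-adj-hub i fzero
  has-neighbour (inj₂ (i , a)) = inj₁ i , hub-adj-leaf i a

  corona-walk : (∀ i j → Walk G (λ _ → ⊤) i j) → ∀ x y → Walk X (λ _ → ⊤) x y
  corona-walk G-walk x y =
    Walk-++ (to-hub x) (Walk-++ (lift (G-walk (part x) (part y))) (from-hub y))
    where
    lift : ∀ {i j} → Walk G (λ _ → ⊤) i j → Walk X (λ _ → ⊤) (inj₁ i) (inj₁ j)
    lift (here _) = here tt
    lift (step _ a r) = step tt a (lift r)

    to-hub : ∀ x → Walk X (λ _ → ⊤) x (inj₁ (part x))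
    to-hub (inj₁ i) = here tt
    to-hub (inj₂ (i , a)) = step tt (leaf-adj-hub i a) (here tt)

    from-hub : ∀ x → Walk X (λ _ → ⊤) (inj₁ (part x)) x
    from-hub (inj₁ i) = here tt
    from-hub (inj₂ (i , a)) = step tt (hub-adj-leaf i a) (here tt)

  hubs : List (CoronaV n k)
  hubs = map inj₁ (allFin n)

  ∈-hubs : ∀ i → inj₁ i ∈ hubs
  ∈-hubs i = ∈-map⁺ inj₁ (∈-allFin i)

  length-hubs : length hubs ≡ n
  length-hubs = trans (length-map inj₁ (allFin n)) (length-tabulate (λ i → i))

  leaves : Fin n → List (CoronaV n k)
  leaves i = map (λ a → inj₂ (i , a)) (allFin (suc (k i)))

  vertices : List (CoronaV n k)
  vertices = hubs ++ concatMap leaves (allFin n)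

  ∈-vertices : ∀ x → x ∈ vertices
  ∈-vertices (inj₁ i) = ∈-++⁺ˡ (∈-hubs i)
  ∈-vertices (inj₂ (i , a)) =
    ∈-++⁺ʳ hubs (∈-concatMap⁺ leaves (lose (∈-allFin i) (∈-map⁺ (λ b → inj₂ (i , b)) (∈-allFin a))))

  part-section⇒injective : (c : Fin n → CoronaV n k) → (∀ j → part (c j) ≡ j) → Injective _≡_ _≡_ c
  part-section⇒injective c part-c {i} {j} eq =
    trans (sym (part-c i)) (trans (cong part eq) (part-c j))

  meets-every-part⇒n≤length : ∀ {S} → (∀ j → ∃ λ x → part x ≡ j × x ∈ S) → n ≤ length S
  meets-every-part⇒n≤length meets =
    injection⇒≤-length (proj₁ ∘ meets) (part-section⇒injective _ (proj₁ ∘ proj₂ ∘ meets))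
                       (proj₂ ∘ proj₂ ∘ meets)

  meets-every-part-avoiding⇒suc-n≤length : ∀ {S h} → h ∈ S →
    (∀ j → ∃ λ x → part x ≡ j × x ∈ S × x ≢ h) → suc n ≤ length S
  meets-every-part-avoiding⇒suc-n≤length h∈S meets =
    injection⇒suc≤-length (proj₁ ∘ meets) (part-section⇒injective _ (proj₁ ∘ proj₂ ∘ meets))
                          (proj₁ ∘ proj₂ ∘ proj₂ ∘ meets) h∈S (proj₂ ∘ proj₂ ∘ proj₂ ∘ meets)

  leaf-move⇒hub∈ : ∀ {S j a i} → InducedConnected X (inj₂ (j , a) ∷ S) → inj₁ i ∈ S → inj₁ j ∈ S
  leaf-move⇒hub∈ c i∈S with Walk-leaf→hub (c _ _ (here refl) (there i∈S))
  ... | there j∈S = j∈S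

module CoronaGames {n : ℕ} (G : Graph (Fin n)) (k : Fin n → ℕ)
                   (H : (i : Fin n) → Graph (Fin (suc (k i))))
                   (i₀ : Fin n) (G-walk : ∀ i j → Walk G (λ _ → ⊤) i j) where
  open CoronaProperties G k H
  open GraphProperties X
  open FiniteConnected X _≟ᵥ_ vertices ∈-vertices (corona-walk G-walk)
  module CG = Game (LegalCG X)
  module TCG = Game (LegalTCG X)

  LegalTCG-leaf-reply : ∀ i → LegalTCG X (inj₁ i ∷ []) (inj₂ (i , fzero))
  LegalTCG-leaf-reply i =
    (λ { (here ()) ; (there ()) })
    , (inj₁ i , leaf-adj-hub i fzero
      , λ { (_ , here refl , a) → Adj-irrefl {inj₁ i} a ; (_ , there () , _) })
    , InducedConnected-∷ InducedConnected-[ inj₁ i ] (here refl) (leaf-adj-hub i fzero)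

  LegalTCG-hub-opening : LegalTCG X [] (inj₁ i₀)
  LegalTCG-hub-opening =
    (λ ()) , (inj₂ (i₀ , fzero) , hub-adj-leaf i₀ fzero , λ { (_ , () , _) })
    , InducedConnected-[ _ ]

  LegalCG-hub-opening : LegalCG X [] (inj₁ i₀)
  LegalCG-hub-opening = (λ ()) , (inj₁ i₀ , inj₁ refl , λ { (_ , () , _) }) , InducedConnected-[ _ ]

  Position-opening : Position (inj₁ i₀ ∷ [])
  Position-opening = Position-move Position-[] LegalCG-hub-opening

  HubPosition : List (CoronaV n k) → Set
  HubPosition S = Position S × S ⊆ hubs × inj₁ i₀ ∈ S

  LegalCG⇒hub : ∀ {S v} → HubPosition S → LegalCG X S v → v ∈ hubs
  LegalCG⇒hub {v = inj₁ j} _ _ = ∈-hubs j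
  LegalCG⇒hub {v = inj₂ _} (_ , _ , i₀∈S) (_ , (_ , c , ¬du) , conn) =
    ⊥-elim (¬du (_ , leaf-move⇒hub∈ conn i₀∈S , leaf-ClosedNbr⇒hub-ClosedNbr c))

  HubPosition-step : ∀ {S v} → HubPosition S → LegalCG X S v → HubPosition (v ∷ S)
  HubPosition-step inv@(pos , S⊆hubs , i₀∈S) l =
    Position-move pos l
    , (λ { (here refl) → LegalCG⇒hub inv l ; (there w∈S) → S⊆hubs w∈S })
    , there i₀∈S

  HubPosition-length≤ : ∀ {S} → HubPosition S → length S ≤ n
  HubPosition-length≤ ((u , _) , S⊆hubs , _) =
    ≤-trans (Unique⇒length≤ u S⊆hubs) (≤-reflexive length-hubs)

  cg-upper : CG.DomAtMost n [] dominator
  cg-upper = CG.dmove (inj₁ i₀) LegalCG-hub-opening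
    (DomAtMost-bound staller (Position-opening , (λ { (here refl) → ∈-hubs i₀ }) , here refl))
    where
    open Play (LegalCG X) HubPosition HubPosition-step (stuck⊎LegalCG ∘ proj₁) n HubPosition-length≤

  cg-lower : CG.StalAtLeast n [] dominator
  cg-lower = StalAtLeast-terminal n each-part-selected dominator Position-[]
    where
    open Play (LegalCG X) Position Position-move
              stuck⊎LegalCG (length vertices) Position-length≤

    each-part-selected : ∀ {S} → Position S → CG.NoMove S → n ≤ length S
    each-part-selected pos stuck = meets-every-part⇒n≤length λ j →
      let (x , x∈S , dom) = stuck⇒dominating pos stuck (inj₂ (j , fzero))
      in x , dominates-leaf⇒same-part dom , x∈S

  HubPosition⁺ : List (CoronaV n k) → Set
  HubPosition⁺ S = ∃ λ h → Position S × S ⊆ h ∷ hubs × inj₁ i₀ ∈ S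
                           × (∀ j → inj₁ j ∈ S → TotallyDominated X S (inj₁ j))

  hub-part-totallyDominated : ∀ {S j} → inj₁ j ∈ S → TotallyDominated X S (inj₁ j) →
                              ∀ u → part u ≡ j → TotallyDominated X S u
  hub-part-totallyDominated j∈S td (inj₁ _) refl = td
  hub-part-totallyDominated j∈S td (inj₂ (_ , b)) refl = _ , j∈S , hub-adj-leaf _ b

  LegalTCG⇒hub : ∀ {S v} → HubPosition⁺ S → LegalTCG X S v → ∃ λ j → v ≡ inj₁ j
  LegalTCG⇒hub {v = inj₁ j} _ _ = j , refl
  LegalTCG⇒hub {v = inj₂ (j , b)} (_ , _ , _ , i₀∈S , td) (_ , (u , a , ¬du) , conn) =
    let j∈S = leaf-move⇒hub∈ conn i₀∈S
    in ⊥-elim (¬du (hub-part-totallyDominated j∈S (td _ j∈S) u (leaf-adj⇒same-part {j} {b} {u} a)))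

  HubPosition⁺-step : ∀ {S v} → HubPosition⁺ S → LegalTCG X S v → HubPosition⁺ (v ∷ S)
  HubPosition⁺-step inv@(h , pos , S⊆ , i₀∈S , td) l@(v∉S , _ , conn)
    with LegalTCG⇒hub inv l | InducedConnected⇒adjacent v∉S i₀∈S conn
  ... | j , refl | w , w∈S , a =
    h , Position-move pos l
    , (λ { (here refl) → there (∈-hubs j) ; (there x∈S) → S⊆ x∈S })
    , there i₀∈S
    , λ { _ (here refl) → w , there w∈S , Adj-sym {inj₁ j} {w} a
        ; j′ (there j′∈S) → let (x , x∈S , b) = td j′ j′∈S in x , there x∈S , b }

  -- Staller's reply v is adjacent to the opening hub, so the two totally dominate each other.
  HubPosition⁺-reply : ∀ v → LegalTCG X (inj₁ i₀ ∷ []) v → HubPosition⁺ (v ∷ inj₁ i₀ ∷ [])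
  HubPosition⁺-reply v l@(v∉S , _ , conn) with InducedConnected⇒adjacent v∉S (here refl) conn
  ... | _ , here refl , a =
    v , Position-move Position-opening l
    , (λ { (here refl) → here refl ; (there (here refl)) → there (∈-hubs i₀) })
    , there (here refl)
    , λ { _ (here refl) → inj₁ i₀ , there (here refl) , Adj-sym {v} {inj₁ i₀} a
        ; _ (there (here refl)) → v , here refl , a }

  HubPosition⁺-length≤ : ∀ {S} → HubPosition⁺ S → length S ≤ suc n
  HubPosition⁺-length≤ (_ , (u , _) , S⊆ , _) =
    ≤-trans (Unique⇒length≤ u S⊆) (≤-reflexive (cong suc length-hubs))

  tcg-upper : TCG.DomAtMost (suc n) [] dominator
  tcg-upper = TCG.dmove (inj₁ i₀) LegalTCG-hub-opening
    (TCG.smove (_ , LegalTCG-leaf-reply i₀)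
      (λ v l → DomAtMost-bound dominator (HubPosition⁺-reply v l)))
    where
    open Play (LegalTCG X) HubPosition⁺ HubPosition⁺-step
              (stuck⊎LegalTCG has-neighbour ∘ proj₁ ∘ proj₂) (suc n) HubPosition⁺-length≤

  LeafPosition : List (CoronaV n k) → Set
  LeafPosition S = Position S × ∃₂ λ j a → inj₂ (j , a) ∈ S

  LeafPosition-step : ∀ {S v} → LeafPosition S → LegalTCG X S v → LeafPosition (v ∷ S)
  LeafPosition-step (pos , j , a , leaf∈S) l = Position-move pos l , j , a , there leaf∈S

  -- In the part of h, take the vertex totally dominating h.
  each-part-and-leaf-selected : ∀ {S} → LeafPosition S → TCG.NoMove S → suc n ≤ length S
  each-part-and-leaf-selected {S} (pos , i , a , h∈S) stuck =
    meets-every-part-avoiding⇒suc-n≤length h∈S meets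
    where
    h = inj₂ (i , a)
    td = stuck⇒totallyDominating has-neighbour pos stuck

    meets : ∀ j → ∃ λ x → part x ≡ j × x ∈ S × x ≢ h
    meets j with j ≟ i | td (inj₂ (j , fzero)) | td h
    ... | yes refl | _ | w , w∈S , aw =
      w , leaf-adj⇒same-part {i} {a} {w} (Adj-sym {w} {h} aw) , w∈S , λ { refl → Adj-irrefl {h} aw }
    ... | no j≢i | y , y∈S , ay | _ =
      let part-y = leaf-adj⇒same-part {j} {fzero} {y} (Adj-sym {y} {inj₂ (j , fzero)} ay)
      in y , part-y , y∈S , λ { refl → j≢i (sym part-y) }

  tcg-lower : TCG.StalAtLeast (suc n) [] dominator
  tcg-lower = TCG.dmove (inj₁ i₀ , LegalTCG-hub-opening) reply
    where
    open Play (LegalTCG X) LeafPosition LeafPosition-step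
              (stuck⊎LegalTCG has-neighbour ∘ proj₁) (length vertices) (Position-length≤ ∘ proj₁)

    reply : ∀ v → LegalTCG X [] v → TCG.StalAtLeast (suc n) (v ∷ []) staller
    reply (inj₁ i) l =
      let pos = Position-move (Position-move Position-[] l) (LegalTCG-leaf-reply i)
      in TCG.smove (inj₂ (i , fzero)) (LegalTCG-leaf-reply i)
           (StalAtLeast-terminal (suc n) each-part-and-leaf-selected dominator
              (pos , i , fzero , here refl))
    reply (inj₂ (i , a)) l =
      StalAtLeast-terminal (suc n) each-part-and-leaf-selected staller
        (Position-move Position-[] l , i , a , here refl)

proposition3p3 : ∀ {n : ℕ} (G : Graph (Fin n)) (k : Fin n → ℕ)
                   (H : (i : Fin n) → Graph (Fin (suc (k i))))
                 → Connected G
                 → Σ ℕ (λ m → IsγCG (corona G k H) m × IsγTCG (corona G k H) (suc m))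
proposition3p3 {n} G k H (i₀ , G-walk) = n , (cg-upper , cg-lower) , (tcg-upper , tcg-lower)
  where open CoronaGames G k H i₀ G-walk
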